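{- Let $n\in\mathbb N$ and let $k$ be a positive integer with $k\not\equiv0\pmod 3$; write $k=3q+\varepsilon$ with $q\in\mathbb N$ and $\varepsilon\in\{ -1,1\}$. Then the map $$\varphi:C_{3,n}\to C_{3,\,k^2n+\frac{k^2-1}3},\qquad (-x-y,x,y)\mapsto\big(-\varepsilon(k(y+x)+q),\ \varepsilon kx,\ \varepsilon(ky+q)\big)$$ is well defined and injective.
   Context: $\mathbb N=\{0,1,2,\ldots\}$. A partition $\lambda$ is determined by its arm set $A^+(\lambda)=\{\lambda_i-i:1\le i\le s\}$ and leg set $L^+(\lambda)=\{\lambda^*_i-i:1\le i\le s\}$ ($s=\#\{i:\lambda_i\ge i\}$, $\lambda^*$ the conjugate); any two finite subsets of $\mathbb N$ of equal size are the leg and arm sets of a unique partition. For $c=(c_0,\ldots,c_{t-1})\in\mathbb Z^t$ with coordinate sum $0$, $\lambda_c$ is the partition with arm set $\{qt+j:0\le q<c_j\}$ and leg set $\{qt+t-j-1:0\le q<-c_j\}$ (over $0\le j\le t-1$), the $t$-core with characteristic vector $c$. $C_{t,n}=\{c\in\mathbb Z^t:\sum c_j=0,\ |\lambda_c|=n\}$. Elements of $C_{3,n}$ are written $(c_0,c_1,c_2)=(-x-y,x,y)$ with $x,y\in\mathbb Z$. -}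

module Defs where

open import Data.Nat as ℕ using (ℕ; zero; suc; _∸_)
open import Data.Integer as ℤ using (ℤ; +_; -[1+_])
open import Data.List as List using (List; []; _∷_; _++_; concatMap; upTo; length; zip)
open import Data.Vec as Vec using (Vec; toList; []; _∷_)
open import Data.Product using (_×_; _,_)
open import Relation.Binary.PropositionalEquality using (_≡_)
open import Data.Nat.ListAction using (sum)

-- Arm set A⁺(λ_c) of the t-core λ_c with characteristic vector c:
--   { q t + j : 0 ≤ q < c_j }  (over 0 ≤ j ≤ t-1), as a list of naturals.
armsAt : ℕ → ℕ → ℤ → List ℕ
armsAt t j (+ m)    = List.map (λ q → q ℕ.* t ℕ.+ j) (upTo m)
armsAt t j -[1+ m ] = []

legsAt : ℕ → ℕ → ℤ → List ℕ
legsAt t j (+ m)    = []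
legsAt t j -[1+ m ] = List.map (λ q → q ℕ.* t ℕ.+ (t ∸ suc j)) (upTo (suc m))

armSet : (t : ℕ) → Vec ℤ t → List ℕ
armSet t c = concatMap (λ p → armsAt t (Data.Product.proj₁ p) (Data.Product.proj₂ p))
                       (zip (upTo t) (toList c))
  where import Data.Product

legSet : (t : ℕ) → Vec ℤ t → List ℕ
legSet t c = concatMap (λ p → legsAt t (Data.Product.proj₁ p) (Data.Product.proj₂ p))
                       (zip (upTo t) (toList c))
  where import Data.Product

-- Size of the partition with arm set A and leg set L (|A| = |L| = s),
-- i.e. with Frobenius coordinates (A | L):  |λ| = s + Σ A + Σ L.
frobeniusSize : List ℕ → List ℕ → ℕ
frobeniusSize A L = length A ℕ.+ sum A ℕ.+ sum L

coreSize : (t : ℕ) → Vec ℤ t → ℕ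
coreSize t c = frobeniusSize (armSet t c) (legSet t c)

vsum : ∀ {t} → Vec ℤ t → ℤ
vsum = Vec.foldr _ ℤ._+_ (+ 0)

InC : (t n : ℕ) → Vec ℤ t → Set
InC t n c = (vsum c ≡ + 0) × (coreSize t c ≡ n)

triple : ℤ → ℤ → Vec ℤ 3
triple x y = (ℤ.- x ℤ.- y) ∷ x ∷ y ∷ []

φ : (k q : ℕ) (ε : ℤ) → Vec ℤ 3 → Vec ℤ 3
φ k q ε (_ ∷ x ∷ y ∷ []) =
  (ℤ.- (ε ℤ.* (+ k ℤ.* (y ℤ.+ x) ℤ.+ + q))) ∷ (ε ℤ.* (+ k ℤ.* x)) ∷ (ε ℤ.* (+ k ℤ.* y ℤ.+ + q)) ∷ []

-- Splitting the arm and leg sets of λ_c by residue mod t, the coordinate c_j contributes an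
-- arithmetic progression with difference t, and summing them gives, for t = 3,
-- 2|λ_c| = Σ_j (3 c_j² + (2j − 1) c_j), a quadratic form in c.  For k = 3q + ε with ε² = 1,
-- substituting φ(c) multiplies this form by k² and adds 2(3q² + 2qε) = 2(k² − 1)/3.
-- Injectivity is read off the coordinates εkx and ε(ky + q) of φ(c).
module Submission where

open import Defs
open import Data.Nat using (ℕ; _*_; _+_; _∸_; _<_; _%_; _/_)
open import Data.Integer as ℤ using (ℤ; +_)
open import Data.Vec using (Vec)
open import Data.Product using (_×_; _,_)
open import Data.Sum using (_⊎_)
open import Relation.Binary.PropositionalEquality using (_≡_; _≢_)

open import Data.Nat as ℕ using (zero; suc; s≤s; z≤n; NonZero)
open import Data.Nat.Properties using (+-identityʳ; *-comm; *-distribˡ-+; *-cancelˡ-≡; m∸n+n≡m; ≤-refl)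
open import Data.Nat.DivMod using (m*n/n≡m)
open import Data.Nat.ListAction using (sum)
open import Data.Nat.ListAction.Properties using (sum-++)
open import Data.Integer using (-[1+_])
import Data.Integer.Properties as ℤ
open import Algebra.Properties.AbelianGroup ℤ.+-0-abelianGroup using (∙-cancelʳ)
open import Data.List using (List; []; _∷_; [_]; _++_; map; concatMap; zip; upTo; length)
open import Data.List.Properties using (map-++; length-++; length-map; length-upTo; upTo-∷ʳ)
open import Data.Vec using (_∷_; []; toList; lookup)
open import Data.Fin using (zero; suc)
open import Data.Sum using (inj₁; inj₂)
open import Relation.Binary.PropositionalEquality using (refl; sym; trans; cong; cong₂; subst; module ≡-Reasoning)
import Data.Nat.Tactic.RingSolver as ℕ-Ring
import Data.Integer.Tactic.RingSolver as ℤ-Ring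
open ≡-Reasoning

IsUnit : ℤ → Set
IsUnit ε = ε ≡ + 1 ⊎ ε ≡ ℤ.- (+ 1)

pos-affine : ∀ a b c d → + (a * (b * c + d)) ≡ + a ℤ.* (+ b ℤ.* + c ℤ.+ + d)
pos-affine a b c d = begin
  + (a * (b * c + d))           ≡⟨ ℤ.pos-* a (b * c + d) ⟩
  + a ℤ.* + (b * c + d)         ≡⟨ cong (+ a ℤ.*_) (ℤ.pos-+ (b * c) d) ⟩
  + a ℤ.* (+ (b * c) ℤ.+ + d)   ≡⟨ cong (λ x → + a ℤ.* (x ℤ.+ + d)) (ℤ.pos-* b c) ⟩
  + a ℤ.* (+ b ℤ.* + c ℤ.+ + d) ∎

sum-map-upTo-suc : ∀ (f : ℕ → ℕ) m → sum (map f (upTo (suc m))) ≡ sum (map f (upTo m)) + f m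
sum-map-upTo-suc f m = begin
  sum (map f (upTo (suc m)))        ≡⟨ cong (λ xs → sum (map f xs)) (upTo-∷ʳ m) ⟨
  sum (map f (upTo m ++ [ m ]))     ≡⟨ cong sum (map-++ f (upTo m) [ m ]) ⟩
  sum (map f (upTo m) ++ [ f m ])   ≡⟨ sum-++ (map f (upTo m)) [ f m ] ⟩
  sum (map f (upTo m)) + (f m + 0)  ≡⟨ cong (sum (map f (upTo m)) ℕ.+_) (+-identityʳ (f m)) ⟩
  sum (map f (upTo m)) + f m        ∎

progression : ℕ → ℕ → ℕ → List ℕ
progression t j m = map (λ i → i * t + j) (upTo m)

twice-sum-progression : ∀ t j m →
  + (2 * sum (progression t j m)) ≡ + t ℤ.* + m ℤ.* + m ℤ.+ (+ 2 ℤ.* + j ℤ.- + t) ℤ.* + m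
twice-sum-progression t j zero    = vanish (+ t) (+ j)
  where
  vanish : ∀ T J → + 0 ≡ T ℤ.* + 0 ℤ.* + 0 ℤ.+ (+ 2 ℤ.* J ℤ.- T) ℤ.* + 0
  vanish = ℤ-Ring.solve-∀
twice-sum-progression t j (suc m) = begin
  + (2 * sum (progression t j (suc m)))
    ≡⟨ cong (λ s → + (2 * s)) (sum-map-upTo-suc (λ i → i * t + j) m) ⟩
  + (2 * (S + (m * t + j)))
    ≡⟨ cong +_ (*-distribˡ-+ 2 S (m * t + j)) ⟩
  + (2 * S + 2 * (m * t + j))
    ≡⟨ ℤ.pos-+ (2 * S) (2 * (m * t + j)) ⟩
  + (2 * S) ℤ.+ + (2 * (m * t + j))
    ≡⟨ cong₂ ℤ._+_ (twice-sum-progression t j m) (pos-affine 2 m t j) ⟩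
  T ℤ.* M ℤ.* M ℤ.+ (+ 2 ℤ.* J ℤ.- T) ℤ.* M ℤ.+ + 2 ℤ.* (M ℤ.* T ℤ.+ J)
    ≡⟨ step T J M ⟩
  T ℤ.* (+ 1 ℤ.+ M) ℤ.* (+ 1 ℤ.+ M) ℤ.+ (+ 2 ℤ.* J ℤ.- T) ℤ.* (+ 1 ℤ.+ M) ∎
  where
  S = sum (progression t j m)
  T = + t
  J = + j
  M = + m
  step : ∀ T J M → T ℤ.* M ℤ.* M ℤ.+ (+ 2 ℤ.* J ℤ.- T) ℤ.* M ℤ.+ + 2 ℤ.* (M ℤ.* T ℤ.+ J)
                 ≡ T ℤ.* (+ 1 ℤ.+ M) ℤ.* (+ 1 ℤ.+ M) ℤ.+ (+ 2 ℤ.* J ℤ.- T) ℤ.* (+ 1 ℤ.+ M)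
  step = ℤ-Ring.solve-∀

runnerSize : ℕ → ℕ → ℤ → ℕ
runnerSize t j c = frobeniusSize (armsAt t j c) (legsAt t j c)

twice-runnerSize : ∀ {t j} → j < t → ∀ c →
  + (2 * runnerSize t j c) ≡ + t ℤ.* c ℤ.* c ℤ.+ (+ 2 ℤ.* + suc j ℤ.- + t) ℤ.* c
twice-runnerSize {t} {j} _ (+ m) = begin
  + (2 * (length P + sum P + 0))
    ≡⟨ cong +_ (arms-only (length P) (sum P)) ⟩
  + (2 * sum P + 2 * length P)
    ≡⟨ ℤ.pos-+ (2 * sum P) (2 * length P) ⟩
  + (2 * sum P) ℤ.+ + (2 * length P)
    ≡⟨ cong₂ ℤ._+_ (twice-sum-progression t j m) (trans (cong (λ l → + (2 * l)) length-P) (ℤ.pos-* 2 m)) ⟩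
  + t ℤ.* + m ℤ.* + m ℤ.+ (+ 2 ℤ.* + j ℤ.- + t) ℤ.* + m ℤ.+ + 2 ℤ.* + m
    ≡⟨ collect (+ t) (+ j) (+ m) ⟩
  + t ℤ.* + m ℤ.* + m ℤ.+ (+ 2 ℤ.* (+ 1 ℤ.+ + j) ℤ.- + t) ℤ.* + m ∎
  where
  P = progression t j m
  arms-only : ∀ l s → 2 * (l + s + 0) ≡ 2 * s + 2 * l
  arms-only = ℕ-Ring.solve-∀
  length-P : length P ≡ m
  length-P = trans (length-map (λ i → i * t + j) (upTo m)) (length-upTo m)
  collect : ∀ T J M → T ℤ.* M ℤ.* M ℤ.+ (+ 2 ℤ.* J ℤ.- T) ℤ.* M ℤ.+ + 2 ℤ.* M
                    ≡ T ℤ.* M ℤ.* M ℤ.+ (+ 2 ℤ.* (+ 1 ℤ.+ J) ℤ.- T) ℤ.* M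
  collect = ℤ-Ring.solve-∀
twice-runnerSize {t} {j} j<t -[1+ m ] = begin
  + (2 * sum (progression t d (suc m)))
    ≡⟨ twice-sum-progression t d (suc m) ⟩
  + t ℤ.* M ℤ.* M ℤ.+ (+ 2 ℤ.* + d ℤ.- + t) ℤ.* M
    ≡⟨ cong (λ T → T ℤ.* M ℤ.* M ℤ.+ (+ 2 ℤ.* + d ℤ.- T) ℤ.* M) t≡d+1+j ⟩
  (+ d ℤ.+ + suc j) ℤ.* M ℤ.* M ℤ.+ (+ 2 ℤ.* + d ℤ.- (+ d ℤ.+ + suc j)) ℤ.* M
    ≡⟨ reflect (+ d) (+ suc j) M ⟩
  (+ d ℤ.+ + suc j) ℤ.* ℤ.- M ℤ.* ℤ.- M ℤ.+ (+ 2 ℤ.* + suc j ℤ.- (+ d ℤ.+ + suc j)) ℤ.* ℤ.- M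
    ≡⟨ cong (λ T → T ℤ.* ℤ.- M ℤ.* ℤ.- M ℤ.+ (+ 2 ℤ.* + suc j ℤ.- T) ℤ.* ℤ.- M) t≡d+1+j ⟨
  + t ℤ.* ℤ.- M ℤ.* ℤ.- M ℤ.+ (+ 2 ℤ.* + suc j ℤ.- + t) ℤ.* ℤ.- M ∎
  where
  d = t ∸ suc j
  M = + suc m
  t≡d+1+j : + t ≡ + d ℤ.+ + suc j
  t≡d+1+j = trans (cong +_ (sym (m∸n+n≡m j<t))) (ℤ.pos-+ d (suc j))
  reflect : ∀ D S M → (D ℤ.+ S) ℤ.* M ℤ.* M ℤ.+ (+ 2 ℤ.* D ℤ.- (D ℤ.+ S)) ℤ.* M
                    ≡ (D ℤ.+ S) ℤ.* ℤ.- M ℤ.* ℤ.- M ℤ.+ (+ 2 ℤ.* S ℤ.- (D ℤ.+ S)) ℤ.* ℤ.- M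
  reflect = ℤ-Ring.solve-∀

frobeniusSize-++ : ∀ A A′ L L′ → frobeniusSize (A ++ A′) (L ++ L′) ≡ frobeniusSize A L + frobeniusSize A′ L′
frobeniusSize-++ A A′ L L′ = begin
  length (A ++ A′) + sum (A ++ A′) + sum (L ++ L′)
    ≡⟨ cong₂ (λ l s → l + s + sum (L ++ L′)) (length-++ A) (sum-++ A A′) ⟩
  length A + length A′ + (sum A + sum A′) + sum (L ++ L′)
    ≡⟨ cong (length A + length A′ + (sum A + sum A′) ℕ.+_) (sum-++ L L′) ⟩
  length A + length A′ + (sum A + sum A′) + (sum L + sum L′)
    ≡⟨ interleave (length A) (length A′) (sum A) (sum A′) (sum L) (sum L′) ⟩
  length A + sum A + sum L + (length A′ + sum A′ + sum L′) ∎
  where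
  interleave : ∀ a a′ s s′ l l′ → a + a′ + (s + s′) + (l + l′) ≡ a + s + l + (a′ + s′ + l′)
  interleave = ℕ-Ring.solve-∀

frobeniusSize-concatMap : ∀ {A : Set} (f g : A → List ℕ) xs →
  frobeniusSize (concatMap f xs) (concatMap g xs) ≡ sum (map (λ x → frobeniusSize (f x) (g x)) xs)
frobeniusSize-concatMap f g []       = refl
frobeniusSize-concatMap f g (x ∷ xs) =
  trans (frobeniusSize-++ (f x) (concatMap f xs) (g x) (concatMap g xs))
        (cong (frobeniusSize (f x) (g x) ℕ.+_) (frobeniusSize-concatMap f g xs))

coreSize-runners : ∀ t c → coreSize t c ≡ sum (map (λ (j , cⱼ) → runnerSize t j cⱼ) (zip (upTo t) (toList c)))
coreSize-runners t c = frobeniusSize-concatMap _ _ (zip (upTo t) (toList c))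

coreForm : Vec ℤ 3 → ℤ
coreForm (a ∷ b ∷ c ∷ []) = + 3 ℤ.* (a ℤ.* a ℤ.+ b ℤ.* b ℤ.+ c ℤ.* c) ℤ.- a ℤ.+ b ℤ.+ + 3 ℤ.* c

twice-coreSize-3 : ∀ v → + (2 * coreSize 3 v) ≡ coreForm v
twice-coreSize-3 (a ∷ b ∷ c ∷ []) = begin
  + (2 * coreSize 3 (a ∷ b ∷ c ∷ []))
    ≡⟨ cong (λ s → + (2 * s)) (coreSize-runners 3 (a ∷ b ∷ c ∷ [])) ⟩
  + (2 * (r₀ + (r₁ + (r₂ + 0))))
    ≡⟨ cong +_ (distribute r₀ r₁ r₂) ⟩
  + (2 * r₀ + (2 * r₁ + 2 * r₂))
    ≡⟨ trans (ℤ.pos-+ (2 * r₀) (2 * r₁ + 2 * r₂)) (cong₂ ℤ._+_ (refl {x = + (2 * r₀)}) (ℤ.pos-+ (2 * r₁) (2 * r₂))) ⟩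
  + (2 * r₀) ℤ.+ (+ (2 * r₁) ℤ.+ + (2 * r₂))
    ≡⟨ cong₂ ℤ._+_ (twice-runnerSize (s≤s z≤n) a)
                   (cong₂ ℤ._+_ (twice-runnerSize (s≤s (s≤s z≤n)) b) (twice-runnerSize ≤-refl c)) ⟩
  _ ≡⟨ combine a b c ⟩
  coreForm (a ∷ b ∷ c ∷ []) ∎
  where
  r₀ = runnerSize 3 0 a
  r₁ = runnerSize 3 1 b
  r₂ = runnerSize 3 2 c
  distribute : ∀ x y z → 2 * (x + (y + (z + 0))) ≡ 2 * x + (2 * y + 2 * z)
  distribute = ℕ-Ring.solve-∀
  combine : ∀ a b c →
    (+ 3 ℤ.* a ℤ.* a ℤ.+ (+ 2 ℤ.* + 1 ℤ.- + 3) ℤ.* a) ℤ.+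
      ((+ 3 ℤ.* b ℤ.* b ℤ.+ (+ 2 ℤ.* + 2 ℤ.- + 3) ℤ.* b) ℤ.+ (+ 3 ℤ.* c ℤ.* c ℤ.+ (+ 2 ℤ.* + 3 ℤ.- + 3) ℤ.* c))
    ≡ + 3 ℤ.* (a ℤ.* a ℤ.+ b ℤ.* b ℤ.+ c ℤ.* c) ℤ.- a ℤ.+ b ℤ.+ + 3 ℤ.* c
  combine = ℤ-Ring.solve-∀

coreForm-scaled : ∀ {ε} → IsUnit ε → ∀ Q x y →
  let K = + 3 ℤ.* Q ℤ.+ ε
      a = ℤ.- (ε ℤ.* (K ℤ.* (y ℤ.+ x) ℤ.+ Q))
      b = ε ℤ.* (K ℤ.* x)
      c = ε ℤ.* (K ℤ.* y ℤ.+ Q)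
      z = ℤ.- x ℤ.- y
  in + 3 ℤ.* (a ℤ.* a ℤ.+ b ℤ.* b ℤ.+ c ℤ.* c) ℤ.- a ℤ.+ b ℤ.+ + 3 ℤ.* c
     ≡ K ℤ.* K ℤ.* (+ 3 ℤ.* (z ℤ.* z ℤ.+ x ℤ.* x ℤ.+ y ℤ.* y) ℤ.- z ℤ.+ x ℤ.+ + 3 ℤ.* y)
       ℤ.+ + 2 ℤ.* (+ 3 ℤ.* Q ℤ.* Q ℤ.+ + 2 ℤ.* Q ℤ.* ε)
coreForm-scaled (inj₁ refl) = ℤ-Ring.solve-∀
coreForm-scaled (inj₂ refl) = ℤ-Ring.solve-∀

coreForm-φ : ∀ {k q ε} → IsUnit ε → + k ≡ + 3 ℤ.* + q ℤ.+ ε → ∀ x y →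
  coreForm (φ k q ε (triple x y))
    ≡ + k ℤ.* + k ℤ.* coreForm (triple x y) ℤ.+ + 2 ℤ.* (+ 3 ℤ.* + q ℤ.* + q ℤ.+ + 2 ℤ.* + q ℤ.* ε)
coreForm-φ {k} {q} {ε} unit k≡3q+ε x y =
  subst (λ K → coreForm (ℤ.- (ε ℤ.* (K ℤ.* (y ℤ.+ x) ℤ.+ + q)) ∷ ε ℤ.* (K ℤ.* x) ∷ ε ℤ.* (K ℤ.* y ℤ.+ + q) ∷ [])
               ≡ K ℤ.* K ℤ.* coreForm (triple x y) ℤ.+ + 2 ℤ.* (+ 3 ℤ.* + q ℤ.* + q ℤ.+ + 2 ℤ.* + q ℤ.* ε))
        (sym k≡3q+ε) (coreForm-scaled unit (+ q) x y)

pos-/-exact : ∀ d .{{_ : NonZero d}} m r → + m ≡ + d ℤ.* r → + (m / d) ≡ r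
pos-/-exact (suc d) m (+ r) m≡dr = cong +_ (begin
  m / suc d          ≡⟨ cong (_/ suc d) (ℤ.+-injective (trans m≡dr (sym (ℤ.pos-* (suc d) r)))) ⟩
  suc d * r / suc d  ≡⟨ cong (_/ suc d) (*-comm (suc d) r) ⟩
  r * suc d / suc d  ≡⟨ m*n/n≡m r (suc d) ⟩
  r                  ∎)
pos-/-exact (suc d) m -[1+ r ] ()

pred-square : ∀ {k q ε} → 0 < k → IsUnit ε → + k ≡ + 3 ℤ.* + q ℤ.+ ε →
  + (k * k ∸ 1) ≡ + 3 ℤ.* (+ 3 ℤ.* + q ℤ.* + q ℤ.+ + 2 ℤ.* + q ℤ.* ε)
pred-square {suc k′} {q} {ε} _ unit k≡3q+ε = begin
  + (k * k ∸ 1)                   ≡⟨ drop-one (+ (k * k ∸ 1)) ⟩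
  + 1 ℤ.+ + (k * k ∸ 1) ℤ.- + 1   ≡⟨ cong (ℤ._- + 1) (ℤ.pos-* k k) ⟩
  + k ℤ.* + k ℤ.- + 1             ≡⟨ cong (λ K → K ℤ.* K ℤ.- + 1) k≡3q+ε ⟩
  (+ 3 ℤ.* + q ℤ.+ ε) ℤ.* (+ 3 ℤ.* + q ℤ.+ ε) ℤ.- + 1 ≡⟨ square unit (+ q) ⟩
  + 3 ℤ.* (+ 3 ℤ.* + q ℤ.* + q ℤ.+ + 2 ℤ.* + q ℤ.* ε) ∎
  where
  k = suc k′
  drop-one : ∀ x → x ≡ + 1 ℤ.+ x ℤ.- + 1
  drop-one = ℤ-Ring.solve-∀
  square : ∀ {ε} → IsUnit ε → ∀ Q →
    (+ 3 ℤ.* Q ℤ.+ ε) ℤ.* (+ 3 ℤ.* Q ℤ.+ ε) ℤ.- + 1 ≡ + 3 ℤ.* (+ 3 ℤ.* Q ℤ.* Q ℤ.+ + 2 ℤ.* Q ℤ.* ε)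
  square (inj₁ refl) = ℤ-Ring.solve-∀
  square (inj₂ refl) = ℤ-Ring.solve-∀

coreSize-φ : ∀ {n k q ε} → 0 < k → IsUnit ε → + k ≡ + 3 ℤ.* + q ℤ.+ ε → ∀ x y →
  coreSize 3 (triple x y) ≡ n → coreSize 3 (φ k q ε (triple x y)) ≡ k * k * n + (k * k ∸ 1) / 3
coreSize-φ {n} {k} {q} {ε} 0<k unit k≡3q+ε x y size≡n =
  *-cancelˡ-≡ (coreSize 3 (φ k q ε (triple x y))) (k * k * n + r) 2 (ℤ.+-injective (begin
    + (2 * coreSize 3 (φ k q ε (triple x y)))
      ≡⟨ twice-coreSize-3 (φ k q ε (triple x y)) ⟩
    coreForm (φ k q ε (triple x y))
      ≡⟨ coreForm-φ unit k≡3q+ε x y ⟩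
    + k ℤ.* + k ℤ.* coreForm (triple x y) ℤ.+ + 2 ℤ.* (+ 3 ℤ.* + q ℤ.* + q ℤ.+ + 2 ℤ.* + q ℤ.* ε)
      ≡⟨ cong₂ (λ f s → + k ℤ.* + k ℤ.* f ℤ.+ + 2 ℤ.* s) form≡2n (sym r≡shift) ⟩
    + k ℤ.* + k ℤ.* + (2 * n) ℤ.+ + 2 ℤ.* + r
      ≡⟨ pos-scaled k (2 * n) r ⟨
    + (k * k * (2 * n) + 2 * r)
      ≡⟨ cong +_ (factor-2 (k * k) n r) ⟩
    + (2 * (k * k * n + r)) ∎))
  where
  r = (k * k ∸ 1) / 3
  r≡shift : + r ≡ + 3 ℤ.* + q ℤ.* + q ℤ.+ + 2 ℤ.* + q ℤ.* ε
  r≡shift = pos-/-exact 3 (k * k ∸ 1) _ (pred-square {q = q} 0<k unit k≡3q+ε)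
  form≡2n : coreForm (triple x y) ≡ + (2 * n)
  form≡2n = trans (sym (twice-coreSize-3 (triple x y))) (cong (λ s → + (2 * s)) size≡n)
  pos-scaled : ∀ k m r → + (k * k * m + 2 * r) ≡ + k ℤ.* + k ℤ.* + m ℤ.+ + 2 ℤ.* + r
  pos-scaled k m r = begin
    + (k * k * m + 2 * r)                 ≡⟨ ℤ.pos-+ (k * k * m) (2 * r) ⟩
    + (k * k * m) ℤ.+ + (2 * r)           ≡⟨ cong₂ ℤ._+_ (ℤ.pos-* (k * k) m) (ℤ.pos-* 2 r) ⟩
    + (k * k) ℤ.* + m ℤ.+ + 2 ℤ.* + r     ≡⟨ cong (λ s → s ℤ.* + m ℤ.+ + 2 ℤ.* + r) (ℤ.pos-* k k) ⟩
    + k ℤ.* + k ℤ.* + m ℤ.+ + 2 ℤ.* + r   ∎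
  factor-2 : ∀ s n r → s * (2 * n) + 2 * r ≡ 2 * (s * n + r)
  factor-2 = ℕ-Ring.solve-∀

vsum-φ : ∀ k q ε v → vsum (φ k q ε v) ≡ + 0
vsum-φ k q ε (_ ∷ x ∷ y ∷ []) = balanced (+ k) (+ q) ε x y
  where
  balanced : ∀ K Q ε x y →
    ℤ.- (ε ℤ.* (K ℤ.* (y ℤ.+ x) ℤ.+ Q)) ℤ.+ (ε ℤ.* (K ℤ.* x) ℤ.+ (ε ℤ.* (K ℤ.* y ℤ.+ Q) ℤ.+ + 0)) ≡ + 0
  balanced = ℤ-Ring.solve-∀

unit-nonZero : ∀ {ε} → IsUnit ε → ℤ.NonZero ε
unit-nonZero (inj₁ refl) = _
unit-nonZero (inj₂ refl) = _

φ-injective : ∀ {k q ε} → 0 < k → IsUnit ε → ∀ x y x′ y′ →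
  φ k q ε (triple x y) ≡ φ k q ε (triple x′ y′) → x ≡ x′ × y ≡ y′
φ-injective {suc k′} {q} {ε} _ unit x y x′ y′ φ≡φ′ =
  ℤ.*-cancelˡ-≡ K x x′ (cancel-ε (cong (λ v → lookup v (suc zero)) φ≡φ′)) ,
  ℤ.*-cancelˡ-≡ K y y′ (∙-cancelʳ (+ q) _ _ (cancel-ε (cong (λ v → lookup v (suc (suc zero))) φ≡φ′)))
  where
  K = + suc k′
  cancel-ε : ∀ {a b} → ε ℤ.* a ≡ ε ℤ.* b → a ≡ b
  cancel-ε = ℤ.*-cancelˡ-≡ ε _ _ {{unit-nonZero unit}}

theorem5p1 : (n k q : ℕ) (ε : ℤ) → 0 < k → k % 3 ≢ 0 →
    (ε ≡ + 1 ⊎ ε ≡ ℤ.- (+ 1)) → + k ≡ + (3 * q) ℤ.+ ε →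
    ((x y : ℤ) → InC 3 n (triple x y) →
      InC 3 (k * k * n + (k * k ∸ 1) / 3) (φ k q ε (triple x y)))
    × ((x y x′ y′ : ℤ) → InC 3 n (triple x y) → InC 3 n (triple x′ y′) →
      φ k q ε (triple x y) ≡ φ k q ε (triple x′ y′) → (x ≡ x′) × (y ≡ y′))
theorem5p1 n k q ε 0<k _ unit k≡3q+ε =
  (λ x y (_ , size≡n) → vsum-φ k q ε (triple x y) , coreSize-φ 0<k unit k≡3q+ε′ x y size≡n) ,
  (λ x y x′ y′ _ _ → φ-injective 0<k unit x y x′ y′)
  where
  k≡3q+ε′ : + k ≡ + 3 ℤ.* + q ℤ.+ ε
  k≡3q+ε′ = trans k≡3q+ε (cong (λ t → t ℤ.+ ε) (ℤ.pos-* 3 q))
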